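{- Let $m,n\ge1$ and let $F\subset\{1,\dots,m\}\times\{1,\dots,n\}$ be a binary image with row sums $r_i=\#\{j:(i,j)\in F\}$ ($i=1,\dots,m$) and column sums $c_j=\#\{i:(i,j)\in F\}$ ($j=1,\dots,n$). Let $L_h$ be the length of the horizontal boundary of $F$. Define $b_i=\#\{j: c_j\ge i\}$ and $d_i=b_i-r_i$ for $i=1,\dots,m$, and set $d_0=d_{m+1}=0$. Then for every integer $t\ge0$ and every choice of indices $0\le i_1<i_2<\dots<i_{2t+1}\le m+1$ we have \[ L_h \ge 2r_1 + d_{i_1}-d_{i_2}+d_{i_3}-\cdots-d_{i_{2t}}+2d_{i_{2t+1}}, \] \[ L_h \ge 2r_1 - d_{i_{2t+1}}+d_{i_{2t}}-d_{i_{2t-1}}+\cdots+d_{i_2}-2d_{i_1}. \]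
   Context: A binary image is a finite set $F\subset\mathbb{Z}^2$; row $i$ is $\{(x,y):x=i\}$ and column $j$ is $\{(x,y):y=j\}$. The horizontal boundary of $F$ is the set of ordered pairs of points $((i,j),(i',j))$ with $|i-i'|=1$, $(i,j)\in F$ and $(i',j)\notin F$ (points outside the $m\times n$ rectangle count as not in $F$); its length is the number of such pairs. -}

module Defs where

open import Data.Bool using (Bool; true; false; _∧_; not; if_then_else_)
open import Data.Nat using (ℕ; zero; suc; _+_; _≤ᵇ_; pred)
open import Data.Integer as ℤ using (ℤ; +_; -_)

-- A binary image is given by its characteristic function F : ℕ → ℕ → Bool,
-- where F i j = true means (i , j) ∈ F.  Rows/columns are 1-indexed as in the paper.
Image : Set
Image = ℕ → ℕ → Bool

InRect : ℕ → ℕ → Image → Set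
InRect m n F = ∀ i j → F i j ≡ true → (1 ≤ i × i ≤ m) × (1 ≤ j × j ≤ n)
  where
  open import Relation.Binary.PropositionalEquality using (_≡_)
  open import Data.Product using (_×_)
  open import Data.Nat using (_≤_)

ind : Bool → ℕ
ind true  = 1
ind false = 0

Σ₁ : ℕ → (ℕ → ℕ) → ℕ
Σ₁ zero    f = 0
Σ₁ (suc n) f = Σ₁ n f + f (suc n)

rowSum : ℕ → Image → ℕ → ℕ
rowSum n F i = Σ₁ n (λ j → ind (F i j))

colSum : ℕ → Image → ℕ → ℕ
colSum m F j = Σ₁ m (λ i → ind (F i j))

bSeq : ℕ → ℕ → Image → ℕ → ℕ
bSeq m n F i = Σ₁ n (λ j → ind (i ≤ᵇ colSum m F j))

-- d_i = b_i - r_i for 1 ≤ i ≤ m, and d_0 = d_{m+1} = 0 (also 0 beyond m+1)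
dSeq : ℕ → ℕ → Image → ℕ → ℤ
dSeq m n F zero    = + 0
dSeq m n F (suc i) =
  if suc i ≤ᵇ m then (+ bSeq m n F (suc i)) ℤ.- (+ rowSum n F (suc i)) else + 0

-- Length of the horizontal boundary: number of ordered pairs ((i,j),(i',j))
-- with |i - i'| = 1, (i,j) ∈ F, (i',j) ∉ F.  Since F ⊆ {1..m}×{1..n}, it
-- suffices to range over i ∈ 1..m, j ∈ 1..n, with i' = i - 1 or i' = i + 1
-- (for i = 1, i' = 0 lies outside the rectangle; F 0 j = false).
horizBoundary : ℕ → ℕ → Image → ℕ
horizBoundary m n F =
  Σ₁ m (λ i → Σ₁ n (λ j →
    ind (F i j ∧ not (F (pred i) j)) + ind (F i j ∧ not (F (suc i) j))))

-- integer sum over k = 0..n-1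
Σℤ : ℕ → (ℕ → ℤ) → ℤ
Σℤ zero    f = + 0
Σℤ (suc n) f = Σℤ n f ℤ.+ f n

altSign : ℕ → ℤ
altSign zero    = + 1
altSign (suc k) = - altSign k

-- The quantities L_h, r₁ and d_i are all sums over the columns of F, so it suffices to prove
-- both inequalities for a single column x ⊆ {1..m} with c ones.  For it d_i = [i ≤ c] − x_i,
-- and the column contributes 2 (x₁ + u) to L_h, u being the number of its runs of ones that do
-- not start in row 1.  The alternating sums telescope against a weight g such that g and d + g
-- are nondecreasing: then d_a − d_b ≤ g_b − g_a for a ≤ b, so either alternating sum is at most
-- g(i_{2t}) − g(i_0).  With g_i = #(runs starting in rows 2..i) + (u if i > c), the remaining
-- terms are controlled by 0 ≤ g_i + 2 d_i ≤ 2 u.  Both facts, and the monotonicity of d + g at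
-- row c, come down to: a hole at or below row c forces a later run, and a one above row c forces
-- an earlier one.
module Submission where

open import Defs
open import Data.Bool using (Bool; true; false; _∧_; not; if_then_else_)
open import Data.Bool.Properties using (∧-zeroʳ; ∧-comm)
open import Data.Nat as ℕ using (ℕ; zero; suc; _+_; _*_; _≤_; _<_; z≤n; s≤s; _≤ᵇ_; pred)
import Data.Nat.Properties as ℕ
import Data.Nat.Tactic.RingSolver as ℕS
open import Data.Integer as ℤ using (ℤ; +_; -_)
import Data.Integer.Properties as ℤ
open import Data.Integer.Tactic.RingSolver using (solve-∀)
open import Data.Product using (_×_; _,_; proj₁; proj₂)
open import Relation.Nullary using (yes; no)
open import Relation.Nullary.Reflects using (ofʸ; ofⁿ)
open import Relation.Nullary.Negation using (contradiction)
open import Relation.Binary.Core using (_Preserves_⟶_)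
open import Relation.Binary.PropositionalEquality
import Algebra.Properties.CommutativeSemigroup as CommSemigroupProperties

open CommSemigroupProperties ℕ.+-commutativeSemigroup using () renaming (interchange to ℕ-interchange)
open CommSemigroupProperties ℤ.+-commutativeSemigroup using () renaming (interchange to ℤ-interchange)

Σ₁-distrib-+ : ∀ n (f g : ℕ → ℕ) → Σ₁ n (λ j → f j + g j) ≡ Σ₁ n f + Σ₁ n g
Σ₁-distrib-+ zero    f g = refl
Σ₁-distrib-+ (suc n) f g =
  trans (cong (_+ (f (suc n) + g (suc n))) (Σ₁-distrib-+ n f g))
        (ℕ-interchange (Σ₁ n f) (Σ₁ n g) (f (suc n)) (g (suc n)))

Σ₁-comm : ∀ m n (h : ℕ → ℕ → ℕ) → Σ₁ m (λ i → Σ₁ n (h i)) ≡ Σ₁ n (λ j → Σ₁ m (λ i → h i j))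
Σ₁-comm zero    n h = sym (Σ₁-zero n)
  where
  Σ₁-zero : ∀ n → Σ₁ n (λ _ → 0) ≡ 0
  Σ₁-zero zero    = refl
  Σ₁-zero (suc n) = cong (_+ 0) (Σ₁-zero n)
Σ₁-comm (suc m) n h =
  trans (cong (_+ Σ₁ n (h (suc m))) (Σ₁-comm m n h)) (sym (Σ₁-distrib-+ n _ (h (suc m))))

Σ₁-mono-≤ : ∀ (f : ℕ → ℕ) {n n′} → n ≤ n′ → Σ₁ n f ≤ Σ₁ n′ f
Σ₁-mono-≤ f {n} {zero}   z≤n = ℕ.≤-refl
Σ₁-mono-≤ f {n} {suc n′} n≤ with n ℕ.≟ suc n′
... | yes refl = ℕ.≤-refl
... | no  n≢   = ℕ.≤-trans (Σ₁-mono-≤ f (ℕ.s≤s⁻¹ (ℕ.≤∧≢⇒< n≤ n≢))) (ℕ.m≤m+n _ _)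

Σ₁-stable : ∀ (f : ℕ → ℕ) {n n′} → n ≤ n′ → (∀ j → n < j → j ≤ n′ → f j ≡ 0) → Σ₁ n′ f ≡ Σ₁ n f
Σ₁-stable f {n} {zero}   z≤n _ = refl
Σ₁-stable f {n} {suc n′} n≤ vanish with n ℕ.≟ suc n′
... | yes refl = refl
... | no  n≢   = begin
  Σ₁ n′ f + f (suc n′)   ≡⟨ cong (_+_ (Σ₁ n′ f)) (vanish (suc n′) n< ℕ.≤-refl) ⟩
  Σ₁ n′ f + 0            ≡⟨ ℕ.+-identityʳ _ ⟩
  Σ₁ n′ f                ≡⟨ Σ₁-stable f (ℕ.s≤s⁻¹ n<) (λ j n<j j≤ → vanish j n<j (ℕ.m≤n⇒m≤1+n j≤)) ⟩
  Σ₁ n f                 ∎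
  where
  open ≡-Reasoning
  n< = ℕ.≤∧≢⇒< n≤ n≢

ind≤1 : ∀ b → ind b ≤ 1
ind≤1 true  = ℕ.≤-refl
ind≤1 false = z≤n

Σ₁-ind-≤ : ∀ n (b : ℕ → Bool) → Σ₁ n (λ j → ind (b j)) ≤ n
Σ₁-ind-≤ zero    b = z≤n
Σ₁-ind-≤ (suc n) b =
  ℕ.≤-trans (ℕ.+-mono-≤ (Σ₁-ind-≤ n b) (ind≤1 (b (suc n)))) (ℕ.≤-reflexive (ℕ.+-comm n 1))

Σ₁-ind-all : ∀ n (b : ℕ → Bool) → (∀ j → 1 ≤ j → j ≤ n → b j ≡ true) → Σ₁ n (λ j → ind (b j)) ≡ n
Σ₁-ind-all zero    b all = refl
Σ₁-ind-all (suc n) b all = begin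
  Σ₁ n (λ j → ind (b j)) + ind (b (suc n))
    ≡⟨ cong₂ _+_ (Σ₁-ind-all n b (λ j 1≤j j≤n → all j 1≤j (ℕ.m≤n⇒m≤1+n j≤n)))
                 (cong ind (all (suc n) (s≤s z≤n) ℕ.≤-refl)) ⟩
  n + 1
    ≡⟨ ℕ.+-comm n 1 ⟩
  suc n ∎
  where open ≡-Reasoning

Σ₁-ind-< : ∀ n (b : ℕ → Bool) → b (suc n) ≡ false → Σ₁ (suc n) (λ j → ind (b j)) < suc n
Σ₁-ind-< n b b≡false rewrite b≡false | ℕ.+-identityʳ (Σ₁ n (λ j → ind (b j))) = s≤s (Σ₁-ind-≤ n b)

ind-fall-rise : ∀ a b → ind (a ∧ not b) + ind b ≡ ind a + ind (not a ∧ b)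
ind-fall-rise true  true  = refl
ind-fall-rise true  false = refl
ind-fall-rise false true  = refl
ind-fall-rise false false = refl

n+n≡2*n : ∀ n → n + n ≡ 2 * n
n+n≡2*n n = cong (_+_ n) (sym (ℕ.+-identityʳ n))

Σ₁ℤ : ℕ → (ℕ → ℤ) → ℤ
Σ₁ℤ zero    f = + 0
Σ₁ℤ (suc n) f = Σ₁ℤ n f ℤ.+ f (suc n)

pos-Σ₁ : ∀ n (f : ℕ → ℕ) → + Σ₁ n f ≡ Σ₁ℤ n (λ j → + f j)
pos-Σ₁ zero    f = refl
pos-Σ₁ (suc n) f = trans (ℤ.pos-+ (Σ₁ n f) (f (suc n))) (cong (ℤ._+ + f (suc n)) (pos-Σ₁ n f))

Σ₁ℤ-zero : ∀ n → Σ₁ℤ n (λ _ → + 0) ≡ + 0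
Σ₁ℤ-zero zero    = refl
Σ₁ℤ-zero (suc n) = cong (ℤ._+ + 0) (Σ₁ℤ-zero n)

Σ₁ℤ-distrib-+ : ∀ n (f g : ℕ → ℤ) → Σ₁ℤ n (λ j → f j ℤ.+ g j) ≡ Σ₁ℤ n f ℤ.+ Σ₁ℤ n g
Σ₁ℤ-distrib-+ zero    f g = refl
Σ₁ℤ-distrib-+ (suc n) f g =
  trans (cong (ℤ._+ (f (suc n) ℤ.+ g (suc n))) (Σ₁ℤ-distrib-+ n f g))
        (ℤ-interchange (Σ₁ℤ n f) (Σ₁ℤ n g) (f (suc n)) (g (suc n)))

Σ₁ℤ-distrib-minus : ∀ n (f g : ℕ → ℤ) → Σ₁ℤ n (λ j → f j ℤ.- g j) ≡ Σ₁ℤ n f ℤ.- Σ₁ℤ n g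
Σ₁ℤ-distrib-minus n f g =
  trans (Σ₁ℤ-distrib-+ n f (λ j → - g j)) (cong (ℤ._+_ (Σ₁ℤ n f)) (Σ₁ℤ-neg n))
  where
  Σ₁ℤ-neg : ∀ n → Σ₁ℤ n (λ j → - g j) ≡ - Σ₁ℤ n g
  Σ₁ℤ-neg zero    = refl
  Σ₁ℤ-neg (suc n) =
    trans (cong (ℤ._+ - g (suc n)) (Σ₁ℤ-neg n)) (sym (ℤ.neg-distrib-+ (Σ₁ℤ n g) (g (suc n))))

*-distribˡ-Σ₁ℤ : ∀ a n (f : ℕ → ℤ) → a ℤ.* Σ₁ℤ n f ≡ Σ₁ℤ n (λ j → a ℤ.* f j)
*-distribˡ-Σ₁ℤ a zero    f = ℤ.*-zeroʳ a
*-distribˡ-Σ₁ℤ a (suc n) f =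
  trans (ℤ.*-distribˡ-+ a (Σ₁ℤ n f) (f (suc n))) (cong (ℤ._+ a ℤ.* f (suc n)) (*-distribˡ-Σ₁ℤ a n f))

Σℤ-Σ₁ℤ-comm : ∀ T n (h : ℕ → ℕ → ℤ) →
  Σℤ T (λ k → Σ₁ℤ n (h k)) ≡ Σ₁ℤ n (λ j → Σℤ T (λ k → h k j))
Σℤ-Σ₁ℤ-comm zero    n h = sym (Σ₁ℤ-zero n)
Σℤ-Σ₁ℤ-comm (suc T) n h =
  trans (cong (ℤ._+ Σ₁ℤ n (h T)) (Σℤ-Σ₁ℤ-comm T n h)) (sym (Σ₁ℤ-distrib-+ n _ (h T)))

Σ₁ℤ-mono-≤ : ∀ n {f g : ℕ → ℤ} → (∀ j → f j ℤ.≤ g j) → Σ₁ℤ n f ℤ.≤ Σ₁ℤ n g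
Σ₁ℤ-mono-≤ zero    f≤g = ℤ.≤-refl
Σ₁ℤ-mono-≤ (suc n) f≤g = ℤ.+-mono-≤ (Σ₁ℤ-mono-≤ n f≤g) (f≤g (suc n))

Σℤ-cong : ∀ T {f g : ℕ → ℤ} → (∀ k → f k ≡ g k) → Σℤ T f ≡ Σℤ T g
Σℤ-cong zero    f≡g = refl
Σℤ-cong (suc T) f≡g = cong₂ ℤ._+_ (Σℤ-cong T f≡g) (f≡g T)

diff-≤-diff : ∀ {a b a′ b′} → a + b′ ≤ a′ + b → + a ℤ.- + b ℤ.≤ + a′ ℤ.- + b′
diff-≤-diff {a} {b} {a′} {b′} h = begin
  + a ℤ.- + b                          ≡⟨ sym (shift (+ a) (+ b) (+ b′)) ⟩
  (+ a ℤ.+ + b′) ℤ.- (+ b ℤ.+ + b′)    ≡⟨ cong (ℤ._- (+ b ℤ.+ + b′)) (sym (ℤ.pos-+ a b′)) ⟩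
  + (a + b′) ℤ.- (+ b ℤ.+ + b′)        ≤⟨ ℤ.+-monoˡ-≤ (- (+ b ℤ.+ + b′)) (ℤ.+≤+ h) ⟩
  + (a′ + b) ℤ.- (+ b ℤ.+ + b′)        ≡⟨ cong (ℤ._- (+ b ℤ.+ + b′)) (ℤ.pos-+ a′ b) ⟩
  (+ a′ ℤ.+ + b) ℤ.- (+ b ℤ.+ + b′)    ≡⟨ swap (+ a′) (+ b) (+ b′) ⟩
  + a′ ℤ.- + b′                        ∎
  where
  open ℤ.≤-Reasoning
  shift : ∀ x y z → (x ℤ.+ z) ℤ.- (y ℤ.+ z) ≡ x ℤ.- y
  shift = solve-∀
  swap : ∀ x y z → (x ℤ.+ y) ℤ.- (y ℤ.+ z) ≡ x ℤ.- z
  swap = solve-∀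

mono-from-step : ∀ (f : ℕ → ℤ) → (∀ k → f k ℤ.≤ f (suc k)) → f Preserves _≤_ ⟶ ℤ._≤_
mono-from-step f step {i} {zero}  z≤n = ℤ.≤-refl
mono-from-step f step {i} {suc j} i≤ with i ℕ.≟ suc j
... | yes refl = ℤ.≤-refl
... | no  i≢   = ℤ.≤-trans (mono-from-step f step (ℕ.s≤s⁻¹ (ℕ.≤∧≢⇒< i≤ i≢))) (step j)

altSign-double : ∀ t → altSign (t + t) ≡ + 1
altSign-double zero    = refl
altSign-double (suc t) rewrite ℕ.+-suc t t | altSign-double t = refl

Σℤ-alternating-pair : ∀ t (a : ℕ → ℤ) →
  Σℤ (suc (suc (t + t))) (λ k → altSign k ℤ.* a k)
    ≡ Σℤ (t + t) (λ k → altSign k ℤ.* a k) ℤ.+ (a (t + t) ℤ.- a (suc (t + t)))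
Σℤ-alternating-pair t a rewrite altSign-double t =
  trans (ℤ.+-assoc (Σℤ (t + t) _) _ _)
        (cong₂ (λ u v → Σℤ (t + t) (λ k → altSign k ℤ.* a k) ℤ.+ (u ℤ.+ v))
               (ℤ.*-identityˡ (a (t + t))) (ℤ.-1*i≡-i (a (suc (t + t)))))

module AlternatingSum (e g : ℕ → ℤ)
  (g-mono : g Preserves ℕ._≤_ ⟶ ℤ._≤_)
  (e+g-mono : (λ i → e i ℤ.+ g i) Preserves ℕ._≤_ ⟶ ℤ._≤_) where

  decrease-≤-increase : ∀ {a b} → a ≤ b → e a ℤ.- e b ℤ.≤ g b ℤ.- g a
  decrease-≤-increase {a} {b} a≤b = begin
    e a ℤ.- e b                           ≡⟨ sym ([x+y]-[z+y]≡x-z (e a) (g a) (e b)) ⟩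
    (e a ℤ.+ g a) ℤ.- (e b ℤ.+ g a)       ≤⟨ ℤ.+-monoˡ-≤ (- (e b ℤ.+ g a)) (e+g-mono a≤b) ⟩
    (e b ℤ.+ g b) ℤ.- (e b ℤ.+ g a)       ≡⟨ [x+y]-[x+z]≡y-z (e b) (g b) (g a) ⟩
    g b ℤ.- g a                           ∎
    where
    open ℤ.≤-Reasoning
    [x+y]-[z+y]≡x-z : ∀ x y z → (x ℤ.+ y) ℤ.- (z ℤ.+ y) ≡ x ℤ.- z
    [x+y]-[z+y]≡x-z = solve-∀
    [x+y]-[x+z]≡y-z : ∀ x y z → (x ℤ.+ y) ℤ.- (x ℤ.+ z) ≡ y ℤ.- z
    [x+y]-[x+z]≡y-z = solve-∀

  pair-step : ∀ {S g₀ a b c d} → S ℤ.≤ g a ℤ.- g₀ → a ≤ b → b ≤ c → c ≤ d →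
    S ℤ.+ (e b ℤ.- e c) ℤ.≤ g d ℤ.- g₀
  pair-step {S} {g₀} {a} {b} {c} {d} S≤ a≤b b≤c c≤d = begin
    S ℤ.+ (e b ℤ.- e c)                   ≤⟨ ℤ.+-mono-≤ S≤ (decrease-≤-increase b≤c) ⟩
    (g a ℤ.- g₀) ℤ.+ (g c ℤ.- g b)        ≤⟨ ℤ.+-monoˡ-≤ (g c ℤ.- g b) (ℤ.+-monoˡ-≤ (- g₀) (g-mono a≤b)) ⟩
    (g b ℤ.- g₀) ℤ.+ (g c ℤ.- g b)        ≡⟨ ℤ.+-comm (g b ℤ.- g₀) (g c ℤ.- g b) ⟩
    (g c ℤ.- g b) ℤ.+ (g b ℤ.- g₀)        ≡⟨ ℤ.+-minus-telescope (g c) (g b) g₀ ⟩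
    g c ℤ.- g₀                            ≤⟨ ℤ.+-monoˡ-≤ (- g₀) (g-mono c≤d) ⟩
    g d ℤ.- g₀                            ∎
    where open ℤ.≤-Reasoning

  alternating-sum-≤ : ∀ t (idx : ℕ → ℕ) → (∀ k → k < t + t → idx k ≤ idx (suc k)) →
    Σℤ (t + t) (λ k → altSign k ℤ.* e (idx k)) ℤ.≤ g (idx (t + t)) ℤ.- g (idx 0)
  alternating-sum-≤ zero    idx mono = ℤ.≤-reflexive (sym (ℤ.+-inverseʳ (g (idx 0))))
  alternating-sum-≤ (suc t) idx mono rewrite ℕ.+-suc t t = begin
    Σℤ (suc (suc (t + t))) (λ k → altSign k ℤ.* e (idx k))
      ≡⟨ Σℤ-alternating-pair t (λ k → e (idx k)) ⟩
    Σℤ (t + t) (λ k → altSign k ℤ.* e (idx k)) ℤ.+ (e (idx (t + t)) ℤ.- e (idx (suc (t + t))))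
      ≤⟨ pair-step (alternating-sum-≤ t idx (λ k k< → mono k (ℕ.m<n⇒m<1+n (ℕ.m<n⇒m<1+n k<))))
                   ℕ.≤-refl (mono (t + t) (ℕ.m<n⇒m<1+n (ℕ.n<1+n _))) (mono (suc (t + t)) ℕ.≤-refl) ⟩
    g (idx (suc (suc (t + t)))) ℤ.- g (idx 0) ∎
    where open ℤ.≤-Reasoning

  alternating-sum-shifted-≤ : ∀ t (idx : ℕ → ℕ) → (∀ k → k < t + t → idx k ≤ idx (suc k)) →
    Σℤ (t + t) (λ k → altSign k ℤ.* e (idx (suc k))) ℤ.≤ g (idx (t + t)) ℤ.- g (idx 0)
  alternating-sum-shifted-≤ zero    idx mono = ℤ.≤-reflexive (sym (ℤ.+-inverseʳ (g (idx 0))))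
  alternating-sum-shifted-≤ (suc t) idx mono rewrite ℕ.+-suc t t = begin
    Σℤ (suc (suc (t + t))) (λ k → altSign k ℤ.* e (idx (suc k)))
      ≡⟨ Σℤ-alternating-pair t (λ k → e (idx (suc k))) ⟩
    Σℤ (t + t) (λ k → altSign k ℤ.* e (idx (suc k)))
      ℤ.+ (e (idx (suc (t + t))) ℤ.- e (idx (suc (suc (t + t)))))
      ≤⟨ pair-step (alternating-sum-shifted-≤ t idx (λ k k< → mono k (ℕ.m<n⇒m<1+n (ℕ.m<n⇒m<1+n k<))))
                   (mono (t + t) (ℕ.m<n⇒m<1+n (ℕ.n<1+n _))) (mono (suc (t + t)) ℕ.≤-refl) ℕ.≤-refl ⟩
    g (idx (suc (suc (t + t)))) ℤ.- g (idx 0) ∎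
    where open ℤ.≤-Reasoning

module Column (m : ℕ) (x : ℕ → Bool)
  (x-zero : x 0 ≡ false) (x-beyond : ∀ {k} → m < k → x k ≡ false) where

  χ : ℕ → ℕ
  χ i = ind (x i)

  c : ℕ
  c = Σ₁ m χ

  -- rise l (fall l) marks a run of ones starting (ending) in row l + 1 (row l), so rises i
  -- counts the runs starting in rows 2, …, i and innerRuns those not starting in row 1.
  rise fall : ℕ → ℕ
  rise l = ind (not (x l) ∧ x (suc l))
  fall l = ind (x l ∧ not (x (suc l)))

  rises : ℕ → ℕ
  rises i = Σ₁ (pred i) rise

  innerRuns : ℕ
  innerRuns = Σ₁ m rise

  x≡true⇒≤m : ∀ {k} → x k ≡ true → k ≤ m
  x≡true⇒≤m {k} xk with k ℕ.≤? m
  ... | yes k≤m = k≤m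
  ... | no  k≰m with () ← trans (sym (x-beyond (ℕ.≰⇒> k≰m))) xk

  c≤m : c ≤ m
  c≤m = Σ₁-ind-≤ m x

  rises-mono : rises Preserves _≤_ ⟶ _≤_
  rises-mono i≤j = Σ₁-mono-≤ rise (ℕ.pred-mono-≤ i≤j)

  rises≤innerRuns : ∀ i → rises i ≤ innerRuns
  rises≤innerRuns i with pred i ℕ.≤? m
  ... | yes i≤m = Σ₁-mono-≤ rise i≤m
  ... | no  i≰m = ℕ.≤-reflexive (Σ₁-stable rise (ℕ.<⇒≤ (ℕ.≰⇒> i≰m)) no-rise)
    where
    no-rise : ∀ j → m < j → j ≤ pred i → rise j ≡ 0
    no-rise j m<j _ rewrite x-beyond (ℕ.m<n⇒m<1+n m<j) = cong ind (∧-zeroʳ (not (x j)))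

  rise-between : ∀ {a b} → 1 ≤ a → a < b → x a ≡ false → x b ≡ true → rises a < rises b
  rise-between {a} {suc b} 1≤a (s≤s a≤b) xa xb = go b a≤b xb
    where
    go : ∀ b → a ≤ b → x (suc b) ≡ true → rises a < rises (suc b)
    go zero    a≤0 _ with () ← ℕ.≤-trans 1≤a a≤0
    go (suc b) a≤ xb with x (suc b) in xb′
    ... | false rewrite xb = ℕ.≤-<-trans (rises-mono a≤) (ℕ.m<m+n _ (s≤s z≤n))
    ... | true  = ℕ.<-≤-trans (go b (ℕ.s≤s⁻¹ (ℕ.≤∧≢⇒< a≤ a≢)) xb′) (ℕ.m≤m+n _ _)
      where
      a≢ : a ≢ suc b
      a≢ refl with () ← trans (sym xa) xb′

  run-after-hole : ∀ {i} → 1 ≤ i → i ≤ c → x i ≡ false → rises i < innerRuns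
  run-after-hole {i@(suc i′)} 1≤i i≤c xi with rises i ℕ.<? innerRuns
  ... | yes r< = r<
  ... | no  r≮ = contradiction i≤c (ℕ.<⇒≱ c<i)
    where
    no-one-after : ∀ j → i < j → j ≤ m → χ j ≡ 0
    no-one-after j i<j _ with x j in xj
    ... | false = refl
    ... | true  = contradiction (ℕ.<-≤-trans (rise-between 1≤i i<j xi xj) (rises≤innerRuns j)) r≮
    c<i : c < i
    c<i = subst (_< i) (sym (Σ₁-stable χ (ℕ.≤-trans i≤c c≤m) no-one-after)) (Σ₁-ind-< i′ x xi)

  run-before-excess : ∀ {i} → c < i → x i ≡ true → 0 < rises i
  run-before-excess {i} c<i xi with rises i in rises≡
  ... | suc _ = s≤s z≤n
  ... | zero  = contradiction i≤c (ℕ.<⇒≱ c<i)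
    where
    one-before : ∀ j → 1 ≤ j → j ≤ i → x j ≡ true
    one-before j 1≤j j≤i with x j in xj
    ... | true  = refl
    ... | false = contradiction (subst (rises j <_) rises≡ (rise-between 1≤j j<i xj xi)) ℕ.n≮0
      where
      j<i : j < i
      j<i = ℕ.≤∧≢⇒< j≤i j≢i
        where
        j≢i : j ≢ i
        j≢i refl with () ← trans (sym xj) xi
    i≤c : i ≤ c
    i≤c = subst (_≤ c) (Σ₁-ind-all i x one-before) (Σ₁-mono-≤ χ (x≡true⇒≤m xi))

  -- The summand of dSeq m n F contributed by this column.
  d : ℕ → ℤ
  d zero    = + 0
  d (suc i) = if suc i ≤ᵇ m then + ind (suc i ≤ᵇ c) ℤ.- + χ (suc i) else + 0

  level : ℕ → ℕ
  level i = ind (i ≤ᵇ c)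

  d-suc : ∀ i → d (suc i) ≡ + level (suc i) ℤ.- + χ (suc i)
  d-suc i with suc i ≤ᵇ m | ℕ.≤ᵇ-reflects-≤ (suc i) m
  ... | true  | _        = refl
  ... | false | ofⁿ i≰m with suc i ≤ᵇ c | ℕ.≤ᵇ-reflects-≤ (suc i) c
  ...   | true  | ofʸ i≤c = contradiction (ℕ.≤-trans i≤c c≤m) i≰m
  ...   | false | _       rewrite x-beyond (ℕ.≰⇒> i≰m) = refl

  -- Away from row c, a unit drop of d = level − χ
  -- is a rise of χ, which rises counts; the drop of level after row c is paid for by bonus
  -- (innerRuns > 0 unless the column is the single run 1..c).
  bonus : ℕ → ℕ
  bonus i = if i ≤ᵇ c then 0 else innerRuns

  g : ℕ → ℕ
  g i = rises i + bonus i

  bonus-mono : bonus Preserves _≤_ ⟶ _≤_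
  bonus-mono {i} {j} i≤j with i ≤ᵇ c | ℕ.≤ᵇ-reflects-≤ i c | j ≤ᵇ c | ℕ.≤ᵇ-reflects-≤ j c
  ... | true  | _       | _     | _       = z≤n
  ... | false | _       | false | _       = ℕ.≤-refl
  ... | false | ofⁿ i≰c | true  | ofʸ j≤c = contradiction (ℕ.≤-trans i≤j j≤c) i≰c

  g-mono : g Preserves _≤_ ⟶ _≤_
  g-mono i≤j = ℕ.+-mono-≤ (rises-mono i≤j) (bonus-mono i≤j)

  g-suc-m : g (suc m) ≡ 2 * innerRuns
  g-suc-m with suc m ≤ᵇ c | ℕ.≤ᵇ-reflects-≤ (suc m) c
  ... | true  | ofʸ m<c = contradiction (ℕ.≤-trans m<c c≤m) (ℕ.n≮n m)
  ... | false | _       = n+n≡2*n innerRuns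

  1≤innerRuns+fall-c : 1 ≤ c → 1 ≤ innerRuns + fall c
  1≤innerRuns+fall-c 1≤c with x c in xc
  ... | false = ℕ.≤-trans (ℕ.≤-trans (s≤s z≤n) (run-after-hole 1≤c ℕ.≤-refl xc)) (ℕ.m≤m+n _ _)
  ... | true with x (suc c) in xc′
  ...   | false = ℕ.m≤n+m 1 innerRuns
  ...   | true  = ℕ.≤-trans (ℕ.≤-trans (run-before-excess (ℕ.n<1+n c) xc′) (rises≤innerRuns (suc c)))
                            (ℕ.m≤m+n _ _)

  level+bonus-step : ∀ p → 1 ≤ p → level p + bonus p ≤ level (suc p) + bonus (suc p) + fall p
  level+bonus-step p 1≤p with p ≤ᵇ c | ℕ.≤ᵇ-reflects-≤ p c | suc p ≤ᵇ c | ℕ.≤ᵇ-reflects-≤ (suc p) c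
  ... | true  | _       | true  | _       = ℕ.m≤m+n 1 (fall p)
  ... | true  | ofʸ p≤c | false | ofⁿ p≮c =
    subst (λ q → 1 ≤ innerRuns + fall q) (sym p≡c) (1≤innerRuns+fall-c (subst (1 ≤_) p≡c 1≤p))
    where
    p≡c : p ≡ c
    p≡c = ℕ.≤-antisym p≤c (ℕ.≮⇒≥ p≮c)
  ... | false | ofⁿ p≰c | true  | ofʸ p<c = contradiction (ℕ.<⇒≤ p<c) p≰c
  ... | false | _       | false | _       = ℕ.m≤m+n innerRuns (fall p)

  Φ : ℕ → ℤ
  Φ i = d i ℤ.+ + g i

  Φ-suc : ∀ i → Φ (suc i) ≡ + (level (suc i) + g (suc i)) ℤ.- + χ (suc i)
  Φ-suc i = begin
    d (suc i) ℤ.+ + G                  ≡⟨ cong (ℤ._+ + G) (d-suc i) ⟩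
    (+ L ℤ.- + X) ℤ.+ + G              ≡⟨ move (+ L) (+ X) (+ G) ⟩
    (+ L ℤ.+ + G) ℤ.- + X              ≡⟨ cong (ℤ._- + X) (ℤ.pos-+ L G) ⟨
    + (L + G) ℤ.- + X                  ∎
    where
    open ≡-Reasoning
    L = level (suc i)
    G = g (suc i)
    X = χ (suc i)
    move : ∀ a b e → (a ℤ.- b) ℤ.+ e ≡ (a ℤ.+ e) ℤ.- b
    move = solve-∀

  level+g-step : ∀ p → level (suc p) + g (suc p) + χ (suc (suc p))
                     ≤ level (suc (suc p)) + g (suc (suc p)) + χ (suc p)
  level+g-step p = begin
    L₁ + (R + B₁) + X₂                ≡⟨ r₁ L₁ R B₁ X₂ ⟩
    R + (L₁ + B₁) + X₂                ≤⟨ ℕ.+-monoˡ-≤ X₂ (ℕ.+-monoʳ-≤ R (level+bonus-step (suc p) 1≤p+1)) ⟩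
    R + (L₂ + B₂ + fall (suc p)) + X₂ ≡⟨ r₂ R L₂ B₂ (fall (suc p)) X₂ ⟩
    R + L₂ + B₂ + (fall (suc p) + X₂) ≡⟨ cong (_+_ (R + L₂ + B₂)) fall+χ≡χ+rise ⟩
    R + L₂ + B₂ + (X₁ + rise (suc p)) ≡⟨ r₃ R L₂ B₂ X₁ (rise (suc p)) ⟩
    L₂ + (R + rise (suc p) + B₂) + X₁ ∎
    where
    open ℕ.≤-Reasoning
    L₁ = level (suc p)
    L₂ = level (suc (suc p))
    B₁ = bonus (suc p)
    B₂ = bonus (suc (suc p))
    R  = rises (suc p)
    X₁ = χ (suc p)
    X₂ = χ (suc (suc p))
    1≤p+1 : 1 ≤ suc p
    1≤p+1 = s≤s z≤n
    fall+χ≡χ+rise : fall (suc p) + X₂ ≡ X₁ + rise (suc p)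
    fall+χ≡χ+rise = ind-fall-rise (x (suc p)) (x (suc (suc p)))
    r₁ : ∀ a b e f → a + (b + e) + f ≡ b + (a + e) + f
    r₁ = ℕS.solve-∀
    r₂ : ∀ a b e f h → a + (b + e + f) + h ≡ a + b + e + (f + h)
    r₂ = ℕS.solve-∀
    r₃ : ∀ a b e f h → a + b + e + (f + h) ≡ b + (a + h + e) + f
    r₃ = ℕS.solve-∀

  χ1≤level1 : χ 1 ≤ level 1
  χ1≤level1 with 1 ≤ᵇ c | ℕ.≤ᵇ-reflects-≤ 1 c | x 1 in x1
  ... | true  | _       | _     = ind≤1 _
  ... | false | _       | false = z≤n
  ... | false | ofⁿ 1≰c | true  =
    contradiction (subst (λ b → 0 + ind b ≤ c) x1 (Σ₁-mono-≤ χ (x≡true⇒≤m x1))) 1≰c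

  Φ-step : ∀ k → Φ k ℤ.≤ Φ (suc k)
  Φ-step zero    = subst (+ 0 ℤ.≤_) (sym (Φ-suc 0))
                         (ℤ.i≤j⇒0≤j-i (ℤ.+≤+ (ℕ.≤-trans χ1≤level1 (ℕ.m≤m+n _ _))))
  Φ-step (suc p) = begin
    Φ (suc p)
      ≡⟨ Φ-suc p ⟩
    + (level (suc p) + g (suc p)) ℤ.- + χ (suc p)
      ≤⟨ diff-≤-diff {b = χ (suc p)} {b′ = χ (suc (suc p))} (level+g-step p) ⟩
    + (level (suc (suc p)) + g (suc (suc p))) ℤ.- + χ (suc (suc p))
      ≡⟨ Φ-suc (suc p) ⟨
    Φ (suc (suc p)) ∎
    where open ℤ.≤-Reasoning

  Φ-mono : Φ Preserves _≤_ ⟶ ℤ._≤_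
  Φ-mono = mono-from-step Φ Φ-step

  g+2level≤2innerRuns+2χ : ∀ i → 1 ≤ i → g i + 2 * level i ≤ 2 * innerRuns + 2 * χ i
  g+2level≤2innerRuns+2χ i 1≤i with i ≤ᵇ c | ℕ.≤ᵇ-reflects-≤ i c
  ... | false | _ = ℕ.+-mono-≤ (ℕ.+-mono-≤ (rises≤innerRuns i) (ℕ.m≤m+n innerRuns 0)) z≤n
  ... | true | ofʸ i≤c with x i in xi
  ...   | true  = ℕ.+-monoˡ-≤ 2 (ℕ.+-mono-≤ (rises≤innerRuns i) z≤n)
  ...   | false = begin
    rises i + 0 + 2            ≡⟨ shuffle (rises i) ⟩
    suc (rises i) + 1          ≤⟨ ℕ.+-mono-≤ hole (ℕ.≤-trans (s≤s z≤n) hole) ⟩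
    innerRuns + innerRuns      ≡⟨ n+n≡2*n innerRuns ⟩
    2 * innerRuns              ≡⟨ ℕ.+-identityʳ _ ⟨
    2 * innerRuns + 0          ∎
    where
    open ℕ.≤-Reasoning
    hole : rises i < innerRuns
    hole = run-after-hole 1≤i i≤c xi
    shuffle : ∀ r → r + 0 + 2 ≡ suc r + 1
    shuffle = ℕS.solve-∀

  2χ≤g+2level : ∀ i → 2 * χ i ≤ g i + 2 * level i
  2χ≤g+2level i with i ≤ᵇ c | ℕ.≤ᵇ-reflects-≤ i c
  ... | true  | _ = ℕ.≤-trans (ℕ.*-monoʳ-≤ 2 (ind≤1 (x i))) (ℕ.m≤n+m 2 _)
  ... | false | ofⁿ i≰c with x i in xi
  ...   | false = z≤n
  ...   | true  = ℕ.≤-trans (ℕ.+-mono-≤ run (ℕ.≤-trans run (rises≤innerRuns i))) (ℕ.m≤m+n _ 0)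
    where
    run : 1 ≤ rises i
    run = run-before-excess (ℕ.≰⇒> i≰c) xi

  g+2d-suc : ∀ i → + g (suc i) ℤ.+ + 2 ℤ.* d (suc i)
                 ≡ + (g (suc i) + 2 * level (suc i)) ℤ.- + (2 * χ (suc i))
  g+2d-suc i = begin
    + G ℤ.+ + 2 ℤ.* d (suc i)                  ≡⟨ cong (λ e → + G ℤ.+ + 2 ℤ.* e) (d-suc i) ⟩
    + G ℤ.+ + 2 ℤ.* (+ L ℤ.- + X)              ≡⟨ distrib (+ 2) (+ G) (+ L) (+ X) ⟩
    (+ G ℤ.+ + 2 ℤ.* + L) ℤ.- + 2 ℤ.* + X      ≡⟨ cong₂ (λ u v → (+ G ℤ.+ u) ℤ.- v)
                                                         (ℤ.pos-* 2 L) (ℤ.pos-* 2 X) ⟨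
    (+ G ℤ.+ + (2 * L)) ℤ.- + (2 * X)          ≡⟨ cong (ℤ._- + (2 * X)) (ℤ.pos-+ G (2 * L)) ⟨
    + (G + 2 * L) ℤ.- + (2 * X)                ∎
    where
    open ≡-Reasoning
    G = g (suc i)
    L = level (suc i)
    X = χ (suc i)
    distrib : ∀ k a b e → a ℤ.+ k ℤ.* (b ℤ.- e) ≡ (a ℤ.+ k ℤ.* b) ℤ.- k ℤ.* e
    distrib = solve-∀

  g+2d≤2innerRuns : ∀ i → + g i ℤ.+ + 2 ℤ.* d i ℤ.≤ + (2 * innerRuns)
  g+2d≤2innerRuns zero    = ℤ.+≤+ z≤n
  g+2d≤2innerRuns (suc i) = begin
    + g (suc i) ℤ.+ + 2 ℤ.* d (suc i)                         ≡⟨ g+2d-suc i ⟩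
    + (g (suc i) + 2 * level (suc i)) ℤ.- + (2 * χ (suc i))   ≤⟨ diff-≤-diff {b′ = 0} upper ⟩
    + (2 * innerRuns) ℤ.- + 0                                 ≡⟨ ℤ.+-identityʳ _ ⟩
    + (2 * innerRuns)                                         ∎
    where
    open ℤ.≤-Reasoning
    upper : g (suc i) + 2 * level (suc i) + 0 ≤ 2 * innerRuns + 2 * χ (suc i)
    upper = ℕ.≤-trans (ℕ.≤-reflexive (ℕ.+-identityʳ _)) (g+2level≤2innerRuns+2χ (suc i) (s≤s z≤n))

  0≤g+2d : ∀ i → + 0 ℤ.≤ + g i ℤ.+ + 2 ℤ.* d i
  0≤g+2d zero    = ℤ.≤-refl
  0≤g+2d (suc i) = subst (+ 0 ℤ.≤_) (sym (g+2d-suc i)) (ℤ.i≤j⇒0≤j-i (ℤ.+≤+ (2χ≤g+2level (suc i))))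

  start : ℕ → ℕ
  start i = ind (x i ∧ not (x (pred i)))

  boundary : ℕ
  boundary = Σ₁ m (λ i → start i + fall i)

  starts+rise : ∀ M → Σ₁ M start + rise M ≡ χ 1 + Σ₁ M rise
  starts+rise zero    rewrite x-zero = ℕ.+-comm 0 (χ 1)
  starts+rise (suc M) = begin
    Σ₁ M start + start (suc M) + rise (suc M)   ≡⟨ cong (λ b → Σ₁ M start + ind b + rise (suc M))
                                                        (∧-comm (x (suc M)) (not (x M))) ⟩
    Σ₁ M start + rise M + rise (suc M)          ≡⟨ cong (_+ rise (suc M)) (starts+rise M) ⟩
    χ 1 + Σ₁ M rise + rise (suc M)              ≡⟨ ℕ.+-assoc (χ 1) _ _ ⟩
    χ 1 + Σ₁ (suc M) rise                       ∎
    where open ≡-Reasoning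

  falls+χ : ∀ M → Σ₁ M fall + χ (suc M) ≡ χ 1 + Σ₁ M rise
  falls+χ zero    = ℕ.+-comm 0 (χ 1)
  falls+χ (suc M) = begin
    Σ₁ M fall + fall (suc M) + χ (suc (suc M))     ≡⟨ ℕ.+-assoc (Σ₁ M fall) _ _ ⟩
    Σ₁ M fall + (fall (suc M) + χ (suc (suc M)))   ≡⟨ cong (_+_ (Σ₁ M fall))
                                                           (ind-fall-rise (x (suc M)) (x (suc (suc M)))) ⟩
    Σ₁ M fall + (χ (suc M) + rise (suc M))         ≡⟨ ℕ.+-assoc (Σ₁ M fall) _ _ ⟨
    Σ₁ M fall + χ (suc M) + rise (suc M)           ≡⟨ cong (_+ rise (suc M)) (falls+χ M) ⟩
    χ 1 + Σ₁ M rise + rise (suc M)                 ≡⟨ ℕ.+-assoc (χ 1) _ _ ⟩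
    χ 1 + Σ₁ (suc M) rise                          ∎
    where open ≡-Reasoning

  boundary≡ : boundary ≡ 2 * (χ 1 + innerRuns)
  boundary≡ = begin
    Σ₁ m (λ i → start i + fall i)         ≡⟨ Σ₁-distrib-+ m start fall ⟩
    Σ₁ m start + Σ₁ m fall                ≡⟨ cong₂ _+_ starts falls ⟩
    χ 1 + innerRuns + (χ 1 + innerRuns)   ≡⟨ n+n≡2*n (χ 1 + innerRuns) ⟩
    2 * (χ 1 + innerRuns)                 ∎
    where
    open ≡-Reasoning
    no-rise-at-m : rise m ≡ 0
    no-rise-at-m rewrite x-beyond (ℕ.n<1+n m) = cong ind (∧-zeroʳ (not (x m)))
    starts : Σ₁ m start ≡ χ 1 + innerRuns
    starts = trans (sym (trans (cong (_+_ (Σ₁ m start)) no-rise-at-m) (ℕ.+-identityʳ _))) (starts+rise m)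
    no-one-at-m+1 : χ (suc m) ≡ 0
    no-one-at-m+1 = cong ind (x-beyond (ℕ.n<1+n m))
    falls : Σ₁ m fall ≡ χ 1 + innerRuns
    falls = trans (sym (trans (cong (_+_ (Σ₁ m fall)) no-one-at-m+1) (ℕ.+-identityʳ _))) (falls+χ m)

  pos-boundary : + boundary ≡ + 2 ℤ.* + χ 1 ℤ.+ + (2 * innerRuns)
  pos-boundary = begin
    + boundary                                 ≡⟨ cong +_ boundary≡ ⟩
    + (2 * (χ 1 + innerRuns))                  ≡⟨ cong +_ (ℕ.*-distribˡ-+ 2 (χ 1) innerRuns) ⟩
    + (2 * χ 1 + 2 * innerRuns)                ≡⟨ ℤ.pos-+ (2 * χ 1) (2 * innerRuns) ⟩
    + (2 * χ 1) ℤ.+ + (2 * innerRuns)          ≡⟨ cong (ℤ._+ + (2 * innerRuns)) (ℤ.pos-* 2 (χ 1)) ⟩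
    + 2 ℤ.* + χ 1 ℤ.+ + (2 * innerRuns)        ∎
    where open ≡-Reasoning

  open AlternatingSum d (λ i → + g i) (λ i≤j → ℤ.+≤+ (g-mono i≤j)) Φ-mono

  column-bound : ∀ t (idx : ℕ → ℕ) → (∀ k → k < t + t → idx k ≤ idx (suc k)) →
    + 2 ℤ.* + χ 1 ℤ.+ Σℤ (t + t) (λ k → altSign k ℤ.* d (idx k)) ℤ.+ + 2 ℤ.* d (idx (t + t))
      ℤ.≤ + boundary
  column-bound t idx mono = begin
    two-χ₁ ℤ.+ Σℤ (t + t) (λ k → altSign k ℤ.* d (idx k)) ℤ.+ + 2 ℤ.* d N
      ≤⟨ ℤ.+-monoˡ-≤ (+ 2 ℤ.* d N) (ℤ.+-monoʳ-≤ two-χ₁ (alternating-sum-≤ t idx mono)) ⟩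
    two-χ₁ ℤ.+ (+ g N ℤ.- + g₀) ℤ.+ + 2 ℤ.* d N
      ≡⟨ regroup two-χ₁ (+ g N) (+ g₀) (+ 2 ℤ.* d N) ⟩
    two-χ₁ ℤ.+ (+ g N ℤ.+ + 2 ℤ.* d N) ℤ.- + g₀
      ≤⟨ ℤ.i-j≤i _ (+ g₀) ⟩
    two-χ₁ ℤ.+ (+ g N ℤ.+ + 2 ℤ.* d N)
      ≤⟨ ℤ.+-monoʳ-≤ two-χ₁ (g+2d≤2innerRuns N) ⟩
    two-χ₁ ℤ.+ + (2 * innerRuns)
      ≡⟨ pos-boundary ⟨
    + boundary ∎
    where
    open ℤ.≤-Reasoning
    two-χ₁ = + 2 ℤ.* + χ 1
    N = idx (t + t)
    g₀ = g (idx 0)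
    regroup : ∀ a b e f → a ℤ.+ (b ℤ.- e) ℤ.+ f ≡ a ℤ.+ (b ℤ.+ f) ℤ.- e
    regroup = solve-∀

  column-bound-shifted : ∀ t (idx : ℕ → ℕ) → (∀ k → k < t + t → idx k ≤ idx (suc k)) →
    idx (t + t) ≤ suc m →
    + 2 ℤ.* + χ 1 ℤ.+ Σℤ (t + t) (λ k → altSign k ℤ.* d (idx (suc k))) ℤ.- + 2 ℤ.* d (idx 0)
      ℤ.≤ + boundary
  column-bound-shifted t idx mono N≤ = begin
    two-χ₁ ℤ.+ Σℤ (t + t) (λ k → altSign k ℤ.* d (idx (suc k))) ℤ.- + 2 ℤ.* d₀
      ≤⟨ ℤ.+-monoˡ-≤ (- (+ 2 ℤ.* d₀)) (ℤ.+-monoʳ-≤ two-χ₁ (alternating-sum-shifted-≤ t idx mono)) ⟩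
    two-χ₁ ℤ.+ (+ g (idx (t + t)) ℤ.- + g₀) ℤ.- + 2 ℤ.* d₀
      ≤⟨ ℤ.+-monoˡ-≤ (- (+ 2 ℤ.* d₀)) (ℤ.+-monoʳ-≤ two-χ₁ (ℤ.+-monoˡ-≤ (- (+ g₀)) (ℤ.+≤+ (g-mono N≤)))) ⟩
    two-χ₁ ℤ.+ (+ g (suc m) ℤ.- + g₀) ℤ.- + 2 ℤ.* d₀
      ≡⟨ regroup two-χ₁ (+ g (suc m)) (+ g₀) (+ 2 ℤ.* d₀) ⟩
    two-χ₁ ℤ.+ + g (suc m) ℤ.- (+ g₀ ℤ.+ + 2 ℤ.* d₀)
      ≤⟨ ℤ.+-monoʳ-≤ (two-χ₁ ℤ.+ + g (suc m)) (ℤ.neg-mono-≤ (0≤g+2d (idx 0))) ⟩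
    two-χ₁ ℤ.+ + g (suc m) ℤ.+ + 0
      ≡⟨ ℤ.+-identityʳ _ ⟩
    two-χ₁ ℤ.+ + g (suc m)
      ≡⟨ cong (λ n → two-χ₁ ℤ.+ + n) g-suc-m ⟩
    two-χ₁ ℤ.+ + (2 * innerRuns)
      ≡⟨ pos-boundary ⟨
    + boundary ∎
    where
    open ℤ.≤-Reasoning
    two-χ₁ = + 2 ℤ.* + χ 1
    d₀ = d (idx 0)
    g₀ = g (idx 0)
    regroup : ∀ a b e f → a ℤ.+ (b ℤ.- e) ℤ.- f ≡ a ℤ.+ b ℤ.- (e ℤ.+ f)
    regroup = solve-∀

module Columns (m n : ℕ) (F : Image) (F⊆ : InRect m n F) where

  row-zero-empty : ∀ j → F 0 j ≡ false
  row-zero-empty j with F 0 j in F0j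
  ... | false = refl
  ... | true  with () ← proj₁ (proj₁ (F⊆ 0 j F0j))

  rows-beyond-empty : ∀ j {k} → m < k → F k j ≡ false
  rows-beyond-empty j {k} m<k with F k j in Fkj
  ... | false = refl
  ... | true  = contradiction (proj₂ (proj₁ (F⊆ k j Fkj))) (ℕ.<⇒≱ m<k)

  module C (j : ℕ) = Column m (λ i → F i j) (row-zero-empty j) (rows-beyond-empty j)

  dSeq-columns : ∀ i → dSeq m n F i ≡ Σ₁ℤ n (λ j → C.d j i)
  dSeq-columns zero    = sym (Σ₁ℤ-zero n)
  dSeq-columns (suc i) with suc i ≤ᵇ m
  ... | true  = trans (cong₂ ℤ._-_ (pos-Σ₁ n _) (pos-Σ₁ n _)) (sym (Σ₁ℤ-distrib-minus n _ _))
  ... | false = sym (Σ₁ℤ-zero n)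

  scaled-dSeq-columns : ∀ a i → a ℤ.* dSeq m n F i ≡ Σ₁ℤ n (λ j → a ℤ.* C.d j i)
  scaled-dSeq-columns a i = trans (cong (a ℤ.*_) (dSeq-columns i)) (*-distribˡ-Σ₁ℤ a n _)

  alternating-dSeq-columns : ∀ T (s : ℕ → ℕ) →
    Σℤ T (λ k → altSign k ℤ.* dSeq m n F (s k)) ≡ Σ₁ℤ n (λ j → Σℤ T (λ k → altSign k ℤ.* C.d j (s k)))
  alternating-dSeq-columns T s =
    trans (Σℤ-cong T (λ k → scaled-dSeq-columns (altSign k) (s k)))
          (Σℤ-Σ₁ℤ-comm T n (λ k j → altSign k ℤ.* C.d j (s k)))

  two-χ₁₁-columns : + 2 ℤ.* + rowSum n F 1 ≡ Σ₁ℤ n (λ j → + 2 ℤ.* + C.χ j 1)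
  two-χ₁₁-columns = trans (cong (+ 2 ℤ.*_) (pos-Σ₁ n _)) (*-distribˡ-Σ₁ℤ (+ 2) n _)

  boundary-columns : + horizBoundary m n F ≡ Σ₁ℤ n (λ j → + C.boundary j)
  boundary-columns = trans (cong +_ (Σ₁-comm m n _)) (pos-Σ₁ n _)

  image-bound : ∀ t (idx : ℕ → ℕ) → (∀ k → k < t + t → idx k ≤ idx (suc k)) →
    + 2 ℤ.* + rowSum n F 1 ℤ.+ Σℤ (t + t) (λ k → altSign k ℤ.* dSeq m n F (idx k))
      ℤ.+ + 2 ℤ.* dSeq m n F (idx (t + t)) ℤ.≤ + horizBoundary m n F
  image-bound t idx mono = begin
    + 2 ℤ.* + rowSum n F 1 ℤ.+ Σℤ (t + t) (λ k → altSign k ℤ.* dSeq m n F (idx k))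
      ℤ.+ + 2 ℤ.* dSeq m n F (idx (t + t))
      ≡⟨ cong₂ ℤ._+_ (cong₂ ℤ._+_ two-χ₁₁-columns (alternating-dSeq-columns (t + t) idx))
                     (scaled-dSeq-columns (+ 2) (idx (t + t))) ⟩
    Σ₁ℤ n row-term ℤ.+ Σ₁ℤ n alt-term ℤ.+ Σ₁ℤ n end-term
      ≡⟨ trans (Σ₁ℤ-distrib-+ n _ end-term)
               (cong (ℤ._+ Σ₁ℤ n end-term) (Σ₁ℤ-distrib-+ n row-term alt-term)) ⟨
    Σ₁ℤ n (λ j → + 2 ℤ.* + C.χ j 1 ℤ.+ Σℤ (t + t) (λ k → altSign k ℤ.* C.d j (idx k))
                   ℤ.+ + 2 ℤ.* C.d j (idx (t + t)))
      ≤⟨ Σ₁ℤ-mono-≤ n (λ j → C.column-bound j t idx mono) ⟩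
    Σ₁ℤ n (λ j → + C.boundary j)
      ≡⟨ boundary-columns ⟨
    + horizBoundary m n F ∎
    where
    open ℤ.≤-Reasoning
    row-term alt-term end-term : ℕ → ℤ
    row-term j = + 2 ℤ.* + C.χ j 1
    alt-term j = Σℤ (t + t) (λ k → altSign k ℤ.* C.d j (idx k))
    end-term j = + 2 ℤ.* C.d j (idx (t + t))

  image-bound-shifted : ∀ t (idx : ℕ → ℕ) → (∀ k → k < t + t → idx k ≤ idx (suc k)) →
    idx (t + t) ≤ suc m →
    + 2 ℤ.* + rowSum n F 1 ℤ.+ Σℤ (t + t) (λ k → altSign k ℤ.* dSeq m n F (idx (suc k)))
      ℤ.- + 2 ℤ.* dSeq m n F (idx 0) ℤ.≤ + horizBoundary m n F
  image-bound-shifted t idx mono N≤ = begin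
    + 2 ℤ.* + rowSum n F 1 ℤ.+ Σℤ (t + t) (λ k → altSign k ℤ.* dSeq m n F (idx (suc k)))
      ℤ.- + 2 ℤ.* dSeq m n F (idx 0)
      ≡⟨ cong₂ ℤ._-_ (cong₂ ℤ._+_ two-χ₁₁-columns (alternating-dSeq-columns (t + t) (λ k → idx (suc k))))
                     (scaled-dSeq-columns (+ 2) (idx 0)) ⟩
    Σ₁ℤ n row-term ℤ.+ Σ₁ℤ n alt-term ℤ.- Σ₁ℤ n start-term
      ≡⟨ trans (Σ₁ℤ-distrib-minus n _ start-term)
               (cong (ℤ._- Σ₁ℤ n start-term) (Σ₁ℤ-distrib-+ n row-term alt-term)) ⟨
    Σ₁ℤ n (λ j → + 2 ℤ.* + C.χ j 1 ℤ.+ Σℤ (t + t) (λ k → altSign k ℤ.* C.d j (idx (suc k)))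
                   ℤ.- + 2 ℤ.* C.d j (idx 0))
      ≤⟨ Σ₁ℤ-mono-≤ n (λ j → C.column-bound-shifted j t idx mono N≤) ⟩
    Σ₁ℤ n (λ j → + C.boundary j)
      ≡⟨ boundary-columns ⟨
    + horizBoundary m n F ∎
    where
    open ℤ.≤-Reasoning
    row-term alt-term start-term : ℕ → ℤ
    row-term j = + 2 ℤ.* + C.χ j 1
    alt-term j = Σℤ (t + t) (λ k → altSign k ℤ.* C.d j (idx (suc k)))
    start-term j = + 2 ℤ.* C.d j (idx 0)

corollary4p5 : (m n : ℕ) → 1 ≤ m → 1 ≤ n → (F : Image) → InRect m n F →
    (t : ℕ) → (idx : ℕ → ℕ) →
    (∀ k → k < t + t → idx k < idx (suc k)) → idx (t + t) ≤ suc m →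
    let d = λ k → dSeq m n F (idx k)
        Lh = + horizBoundary m n F
        r₁ = + rowSum n F 1
    in ((+ 2 ℤ.* r₁) ℤ.+ Σℤ (t + t) (λ k → altSign k ℤ.* d k) ℤ.+ (+ 2 ℤ.* d (t + t)) ℤ.≤ Lh)
     × ((+ 2 ℤ.* r₁) ℤ.+ Σℤ (t + t) (λ k → altSign k ℤ.* d (suc k))
          ℤ.- (+ 2 ℤ.* d 0) ℤ.≤ Lh)
corollary4p5 m n _ _ F F⊆ t idx increasing N≤ =
  image-bound t idx mono , image-bound-shifted t idx mono N≤
  where
  open Columns m n F F⊆
  mono : ∀ k → k < t + t → idx k ≤ idx (suc k)
  mono k k< = ℕ.<⇒≤ (increasing k k<)
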